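{- Let $x,y$ be indeterminates and let $(M_{n,k})$ be defined by $M_{0,0}=1$, $M_{0,k}=0$ ($k>0$), and for $n\ge1$: $M_{n,0}=xM_{n-1,0}$ and $M_{n,k}=M_{n-1,k-1}+yM_{n-1,k}$ ($k\ge1$). Then for every integer $n\ge0$, $$\sum_{k=0}^{n}y^{2k}\det\begin{pmatrix}M_{n,k}&M_{n,k+1}\\ M_{n+1,k}&M_{n+1,k+1}\end{pmatrix}=\sum_{k=0}^{n}C_{n,k}\,x^ky^{2n-k},$$ where $C_{n,k}=\frac{k+1}{n+1}\binom{2n-k}{n}$ are the ballot numbers. -}

module Defs where

open import Level using (Level)
open import Data.Nat using (ℕ; zero; suc; _∸_; _/_)
import Data.Nat as ℕ
open import Data.Nat.Combinatorics using (_C_)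
open import Data.Fin using (Fin; toℕ)
open import Algebra.Bundles using (CommutativeRing; Semiring)
import Algebra.Definitions.RawSemiring as RS

-- Ballot numbers C_{n,k} = (k+1)/(n+1) * binom(2n-k, n)  (exact division for k ≤ n)
ballot : ℕ → ℕ → ℕ
ballot n k = ((suc k) ℕ.* ((2 ℕ.* n ∸ k) C n)) / (suc n)

module _ {c ℓ : Level} (R : CommutativeRing c ℓ) where
  open CommutativeRing R using (Carrier; _+_; _*_; _-_; 0#; 1#; semiring)
  open RS (Semiring.rawSemiring semiring) using (_×_; _^_; sum)

  Mtri : Carrier → Carrier → ℕ → ℕ → Carrier
  Mtri x y zero    zero    = 1#
  Mtri x y zero    (suc k) = 0#
  Mtri x y (suc n) zero    = x * Mtri x y n zero
  Mtri x y (suc n) (suc k) = Mtri x y n k + y * Mtri x y n (suc k)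

  det2 : Carrier → Carrier → ℕ → ℕ → Carrier
  det2 x y n k = Mtri x y n k * Mtri x y (suc n) (suc k)
                 - Mtri x y n (suc k) * Mtri x y (suc n) k

  lhs : Carrier → Carrier → ℕ → Carrier
  lhs x y n = sum {suc n} (λ (i : Fin (suc n)) →
                 (y ^ (2 ℕ.* toℕ i)) * det2 x y n (toℕ i))

  rhs : Carrier → Carrier → ℕ → Carrier
  rhs x y n = sum {suc n} (λ (i : Fin (suc n)) →
                 (ballot n (toℕ i) × ((x ^ toℕ i) * (y ^ (2 ℕ.* n ∸ toℕ i)))))

-- Let J(p,q) = Σ_{k≤p} y^{2k} (M_{p,k} M_{q+1,k+1} − M_{p,k+1} M_{q+1,k}), so the left-hand side
-- is J(n,n). Expanding rows p+1 and q+2 by the recurrence of M gives, column by column, an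
-- identity whose sum telescopes to J(p+1,q+1) = y J(p,q+1) + y J(p+1,q); moreover J(p+1,p) = 0
-- (two equal rows) and J(0,q) = M_{q+1,1} = Σ_{a≤q} x^a y^{q−a}. Hence J(n,n+d) is homogeneous of
-- degree 2n+d, and its coefficients obey a ballot-type recurrence in (n,d) whose solution is
-- binom(2n+d−a, n) − binom(2n+d−a, n+d+1); for d = 0 this is the ballot number C_{n,a}.

module Submission where

open import Defs
open import Level using (Level)
open import Data.Nat using (ℕ; zero; suc; _∸_; _<_; _≤_; s≤s)
open import Algebra.Bundles using (CommutativeRing; Semiring)
import Data.Nat as ℕ
import Data.Nat.Properties as ℕ

-- The ring solver needs coefficients whose equality it can decide in order to cancel terms such
-- as u − u; ℤ, mapped canonically into R, serves. The type-checking optimised _×_ makes ι 0ℤ and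
-- ι 1ℤ compute to 0# and 1#, so that con 0ℤ and con 1ℤ match 0# and 1# in goals.
module IntegerCoefficients {c ℓ : Level} (R : CommutativeRing c ℓ) where
  open import Data.Integer as ℤ using (ℤ; +_; -[1+_]; _⊖_; 1ℤ)
  import Data.Integer.Properties as ℤ
  open import Data.Maybe using (Maybe; just; nothing)
  open import Relation.Nullary using (yes; no)
  import Relation.Binary.PropositionalEquality as P
  open import Algebra.Solver.Ring.AlmostCommutativeRing
    using (_-Raw-AlmostCommutative⟶_; fromCommutativeRing)
  open CommutativeRing R
  open import Algebra.Properties.Semiring.Mult.TCOptimised semiring using (_×_; ×-homo-+)
  open import Algebra.Properties.Ring ring using (-‿distribˡ-*; -0#≈0#; -‿involutive)
  open import Algebra.Properties.AbelianGroup +-abelianGroup using (⁻¹-anti-homo-∙; xyx⁻¹≈y)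
  open import Relation.Binary.Reasoning.Setoid setoid

  ι : ℤ → Carrier
  ι (+ n)    = n × 1#
  ι -[1+ n ] = - (suc n × 1#)

  ι-⊖ : ∀ m n → ι (m ⊖ n) ≈ m × 1# - n × 1#
  ι-⊖ m       zero    = trans (sym (+-identityʳ _)) (+-congˡ (sym -0#≈0#))
  ι-⊖ zero    (suc n) = sym (+-identityˡ _)
  ι-⊖ (suc m) (suc n) = begin
    ι (suc m ⊖ suc n)                      ≡⟨ P.cong ι (ℤ.[1+m]⊖[1+n]≡m⊖n m n) ⟩
    ι (m ⊖ n)                              ≈⟨ ι-⊖ m n ⟩
    m × 1# - n × 1#                        ≈⟨ xyx⁻¹≈y 1# (m × 1# - n × 1#) ⟨
    1# + (m × 1# - n × 1#) - 1#            ≈⟨ +-congʳ (+-assoc 1# _ _) ⟨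
    1# + m × 1# - n × 1# - 1#              ≈⟨ +-assoc _ _ _ ⟩
    1# + m × 1# + (- (n × 1#) + - 1#)      ≈⟨ +-cong (×-homo-+ 1# 1 m) (⁻¹-anti-homo-∙ 1# (n × 1#)) ⟨
    suc m × 1# - (1# + n × 1#)             ≈⟨ +-congˡ (-‿cong (×-homo-+ 1# 1 n)) ⟨
    suc m × 1# - suc n × 1#                ∎

  ι-neg : ∀ i → ι (ℤ.- i) ≈ - ι i
  ι-neg -[1+ n ]    = sym (-‿involutive _)
  ι-neg (+ zero)    = sym -0#≈0#
  ι-neg (+ (suc n)) = refl

  ι-+ : ∀ i j → ι (i ℤ.+ j) ≈ ι i + ι j
  ι-+ (+ m)    (+ n)    = ×-homo-+ 1# m n
  ι-+ (+ m)    -[1+ n ] = ι-⊖ m (suc n)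
  ι-+ -[1+ m ] (+ n)    = trans (ι-⊖ n (suc m)) (+-comm _ _)
  ι-+ -[1+ m ] -[1+ n ] = begin
    - (suc (suc (m ℕ.+ n)) × 1#)           ≡⟨ P.cong (λ k → - (k × 1#)) (ℕ.+-suc (suc m) n) ⟨
    - ((suc m ℕ.+ suc n) × 1#)             ≈⟨ -‿cong (×-homo-+ 1# (suc m) (suc n)) ⟩
    - (suc m × 1# + suc n × 1#)            ≈⟨ ⁻¹-anti-homo-∙ _ _ ⟩
    - (suc n × 1#) - suc m × 1#            ≈⟨ +-comm _ _ ⟩
    - (suc m × 1#) - suc n × 1#            ∎

  ι-*ˡ : ∀ m j → ι (+ m ℤ.* j) ≈ m × 1# * ι j
  ι-*ˡ zero    j = sym (zeroˡ (ι j))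
  ι-*ˡ (suc m) j = begin
    ι ((1ℤ ℤ.+ + m) ℤ.* j)                 ≡⟨ P.cong ι (ℤ.*-distribʳ-+ j 1ℤ (+ m)) ⟩
    ι (1ℤ ℤ.* j ℤ.+ + m ℤ.* j)             ≈⟨ ι-+ (1ℤ ℤ.* j) (+ m ℤ.* j) ⟩
    ι (1ℤ ℤ.* j) + ι (+ m ℤ.* j)           ≈⟨ +-cong (reflexive (P.cong ι (ℤ.*-identityˡ j))) (ι-*ˡ m j) ⟩
    ι j + m × 1# * ι j                     ≈⟨ +-congʳ (*-identityˡ (ι j)) ⟨
    1# * ι j + m × 1# * ι j                ≈⟨ distribʳ (ι j) 1# (m × 1#) ⟨
    (1# + m × 1#) * ι j                    ≈⟨ *-congʳ (×-homo-+ 1# 1 m) ⟨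
    suc m × 1# * ι j                       ∎

  ι-* : ∀ i j → ι (i ℤ.* j) ≈ ι i * ι j
  ι-* (+ m)    j = ι-*ˡ m j
  ι-* -[1+ m ] j = begin
    ι (-[1+ m ] ℤ.* j)                     ≡⟨ P.cong ι (ℤ.neg-distribˡ-* (+ suc m) j) ⟨
    ι (ℤ.- (+ suc m ℤ.* j))                ≈⟨ ι-neg (+ suc m ℤ.* j) ⟩
    - ι (+ suc m ℤ.* j)                    ≈⟨ -‿cong (ι-*ˡ (suc m) j) ⟩
    - (suc m × 1# * ι j)                   ≈⟨ -‿distribˡ-* _ _ ⟩
    - (suc m × 1#) * ι j                   ∎

  ι-homomorphism : ℤ.+-*-rawRing -Raw-AlmostCommutative⟶ fromCommutativeRing R
  ι-homomorphism = record
    { ⟦_⟧ = ι ; +-homo = ι-+ ; *-homo = ι-* ; -‿homo = ι-neg ; 0-homo = refl ; 1-homo = refl }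

  ι-equal? : ∀ i j → Maybe (ι i ≈ ι j)
  ι-equal? i j with i ℤ.≟ j
  ... | yes i≡j = just (reflexive (P.cong ι i≡j))
  ... | no _    = nothing

  open import Algebra.Solver.Ring ℤ.+-*-rawRing (fromCommutativeRing R) ι-homomorphism ι-equal? public

module BallotTable where
  open import Data.Nat
  open import Data.Nat.Properties
  open import Data.Nat.Combinatorics
  open import Data.Nat.DivMod using (m*n/n≡m)
  open import Relation.Binary.PropositionalEquality
  open ≡-Reasoning
  open import Algebra.Properties.CommutativeSemigroup +-commutativeSemigroup using (interchange; x∙yz≈y∙xz)

  ≤-indicator : ℕ → ℕ → ℕ
  ≤-indicator zero    d       = 1
  ≤-indicator (suc a) zero    = 0
  ≤-indicator (suc a) (suc d) = ≤-indicator a d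

  ≤⇒≤-indicator≡1 : ∀ {a d} → a ≤ d → ≤-indicator a d ≡ 1
  ≤⇒≤-indicator≡1 {zero}  _         = refl
  ≤⇒≤-indicator≡1 {suc a} (s≤s a≤d) = ≤⇒≤-indicator≡1 a≤d

  >⇒≤-indicator≡0 : ∀ {a d} → d < a → ≤-indicator a d ≡ 0
  >⇒≤-indicator≡0 {suc a} {zero}  _         = refl
  >⇒≤-indicator≡0 {suc a} {suc d} (s≤s d<a) = >⇒≤-indicator≡0 d<a

  -- ballotTable n d a is the coefficient of x^a y^(2n+d−a) in offsetMinorSum n d.
  ballotTable : ℕ → ℕ → ℕ → ℕ
  ballotTable zero    d       a = ≤-indicator a d
  ballotTable (suc n) zero    a = ballotTable n 1 a
  ballotTable (suc n) (suc d) a = ballotTable n (suc (suc d)) a + ballotTable (suc n) d a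

  >⇒ballotTable≡0 : ∀ n d a → d + n < a → ballotTable n d a ≡ 0
  >⇒ballotTable≡0 zero    d       a d+0<a = >⇒≤-indicator≡0 (≤-trans (s≤s (m≤m+n d 0)) d+0<a)
  >⇒ballotTable≡0 (suc n) zero    a n<a   = >⇒ballotTable≡0 n 1 a n<a
  >⇒ballotTable≡0 (suc n) (suc d) a d+n<a = cong₂ _+_
    (>⇒ballotTable≡0 n (suc (suc d)) a (subst (_< a) (cong suc (+-suc d n)) d+n<a))
    (>⇒ballotTable≡0 (suc n) d a (<-trans (n<1+n (d + suc n)) d+n<a))

  [k+1]*[n+1]C[k+1]≡[n+1]*nCk : ∀ n k → suc k * (suc n C suc k) ≡ suc n * (n C k)
  [k+1]*[n+1]C[k+1]≡[n+1]*nCk zero    zero    = refl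
  [k+1]*[n+1]C[k+1]≡[n+1]*nCk zero    (suc k) =
    trans (cong (suc (suc k) *_) (k>n⇒nCk≡0 {1} {suc (suc k)} (s≤s (s≤s z≤n)))) (*-zeroʳ (suc (suc k)))
  [k+1]*[n+1]C[k+1]≡[n+1]*nCk (suc n) zero    =
    trans (*-identityˡ _) (trans (nC1≡n (suc (suc n))) (sym (*-identityʳ (suc (suc n)))))
  [k+1]*[n+1]C[k+1]≡[n+1]*nCk (suc n) (suc k) = begin
    suc (suc k) * (suc (suc n) C suc (suc k))
      ≡⟨ cong (suc (suc k) *_) (nCk+nC[k+1]≡[n+1]C[k+1] (suc n) (suc k)) ⟨
    suc (suc k) * (X + suc n C suc (suc k))
      ≡⟨ *-distribˡ-+ (suc (suc k)) X _ ⟩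
    (X + suc k * X) + suc (suc k) * (suc n C suc (suc k))
      ≡⟨ cong₂ (λ u v → (X + u) + v) ([k+1]*[n+1]C[k+1]≡[n+1]*nCk n k) ([k+1]*[n+1]C[k+1]≡[n+1]*nCk n (suc k)) ⟩
    (X + suc n * (n C k)) + suc n * (n C suc k)
      ≡⟨ +-assoc X _ _ ⟩
    X + (suc n * (n C k) + suc n * (n C suc k))
      ≡⟨ cong (X +_) (*-distribˡ-+ (suc n) (n C k) _) ⟨
    X + suc n * (n C k + n C suc k)
      ≡⟨ cong (λ z → X + suc n * z) (nCk+nC[k+1]≡[n+1]C[k+1] n k) ⟩
    suc (suc n) * X ∎
    where X = suc n C suc k

  [m+n]Cm≡[m+n]Cn : ∀ m n → (m + n) C m ≡ (m + n) C n
  [m+n]Cm≡[m+n]Cn m n = trans (nCk≡nC[n∸k] (m≤m+n m n)) (cong ((m + n) C_) (m+n∸m≡n m n))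

  [n+1]*[n+b]C[n+1]≡b*[n+b]Cn : ∀ n b → suc n * ((n + b) C suc n) ≡ b * ((n + b) C n)
  [n+1]*[n+b]C[n+1]≡b*[n+b]Cn n zero    = begin
    suc n * ((n + 0) C suc n) ≡⟨ cong (suc n *_) (k>n⇒nCk≡0 (s≤s (≤-reflexive (+-identityʳ n)))) ⟩
    suc n * 0                 ≡⟨ *-zeroʳ (suc n) ⟩
    0                         ∎
  [n+1]*[n+b]C[n+1]≡b*[n+b]Cn n (suc b) = begin
    suc n * ((n + suc b) C suc n) ≡⟨ cong (λ m → suc n * (m C suc n)) (+-suc n b) ⟩
    suc n * (suc (n + b) C suc n) ≡⟨ [k+1]*[n+1]C[k+1]≡[n+1]*nCk (n + b) n ⟩
    suc (n + b) * ((n + b) C n)   ≡⟨ cong (suc (n + b) *_) ([m+n]Cm≡[m+n]Cn n b) ⟩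
    suc (n + b) * ((n + b) C b)   ≡⟨ [k+1]*[n+1]C[k+1]≡[n+1]*nCk (n + b) b ⟨
    suc b * (suc (n + b) C suc b) ≡⟨ cong (λ m → suc b * (m C suc b)) (+-suc n b) ⟨
    suc b * ((n + suc b) C suc b) ≡⟨ cong (suc b *_) ([m+n]Cm≡[m+n]Cn n (suc b)) ⟨
    suc b * ((n + suc b) C n)     ∎

  ballotTable-closed-form : ∀ n d a b → a + b ≡ d + n →
                    ballotTable n d a + (n + b) C suc (d + n) ≡ (n + b) C n
  ballotTable-closed-form zero d a b a+b≡d+0 = cong₂ _+_
    (≤⇒≤-indicator≡1 (≤-trans (m≤m+n a b) (≤-trans (≤-reflexive a+b≡d+0) (≤-reflexive (+-identityʳ d)))))
    (k>n⇒nCk≡0 (s≤s (≤-trans (m≤n+m b a) (≤-reflexive a+b≡d+0))))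
  ballotTable-closed-form (suc n) zero a b a+b≡1+n = begin
    ballotTable n 1 a + suc N C suc (suc n)             ≡⟨ cong (ballotTable n 1 a +_) (nCk+nC[k+1]≡[n+1]C[k+1] N (suc n)) ⟨
    ballotTable n 1 a + (N C suc n + N C suc (suc n))   ≡⟨ x∙yz≈y∙xz (ballotTable n 1 a) (N C suc n) (N C suc (suc n)) ⟩
    N C suc n + (ballotTable n 1 a + N C suc (suc n))   ≡⟨ cong (N C suc n +_) (ballotTable-closed-form n 1 a b a+b≡1+n) ⟩
    N C suc n + N C n                                   ≡⟨ +-comm (N C suc n) (N C n) ⟩
    N C n + N C suc n                                   ≡⟨ nCk+nC[k+1]≡[n+1]C[k+1] N n ⟩
    suc N C suc n                                       ∎
    where N = n + b
  ballotTable-closed-form (suc n) (suc d) a b a+b≡d+n+2 = begin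
    (T₁ + T₂) + suc N C suc K                  ≡⟨ cong ((T₁ + T₂) +_) (nCk+nC[k+1]≡[n+1]C[k+1] N K) ⟨
    (T₁ + T₂) + (N C K + N C suc K)            ≡⟨ cong ((T₁ + T₂) +_) (+-comm (N C K) (N C suc K)) ⟩
    (T₁ + T₂) + (N C suc K + N C K)            ≡⟨ interchange T₁ T₂ (N C suc K) (N C K) ⟩
    (T₁ + N C suc K) + (T₂ + N C K)            ≡⟨ cong₂ _+_ first (second b a+b≡d+n+2) ⟩
    N C n + N C suc n                          ≡⟨ nCk+nC[k+1]≡[n+1]C[k+1] N n ⟩
    suc N C suc n                              ∎
    where
    N = n + b
    K = suc (d + suc n)
    T₁ = ballotTable n (suc (suc d)) a
    T₂ = ballotTable (suc n) d a
    first : T₁ + N C suc K ≡ N C n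
    first rewrite +-suc d n = ballotTable-closed-form n (suc (suc d)) a b a+b≡d+n+2
    second : ∀ b → a + b ≡ K → T₂ + (n + b) C K ≡ (n + b) C suc n
    second zero    a+0≡K = begin
      T₂ + (n + 0) C K   ≡⟨ cong₂ _+_ (>⇒ballotTable≡0 (suc n) d a K≤a) (k>n⇒nCk≡0 (s≤s n+0≤d+n+1)) ⟩
      0                  ≡⟨ k>n⇒nCk≡0 (s≤s (≤-reflexive (+-identityʳ n))) ⟨
      (n + 0) C suc n    ∎
      where
      K≤a : K ≤ a
      K≤a = ≤-reflexive (trans (sym a+0≡K) (+-identityʳ a))
      n+0≤d+n+1 : n + 0 ≤ d + suc n
      n+0≤d+n+1 = ≤-trans (≤-reflexive (+-identityʳ n)) (≤-trans (n≤1+n n) (m≤n+m (suc n) d))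
    second (suc b) a+b+1≡K rewrite +-suc n b =
      ballotTable-closed-form (suc n) d a b (suc-injective (trans (sym (+-suc a b)) a+b+1≡K))

  ballot≡ballotTable : ∀ n a → a ≤ n → ballot n a ≡ ballotTable n 0 a
  ballot≡ballotTable n a a≤n = begin
    (suc a * ((2 * n ∸ a) C n)) / suc n   ≡⟨ cong (λ m → (suc a * (m C n)) / suc n) 2n∸a≡n+b ⟩
    (suc a * X) / suc n                   ≡⟨ cong (_/ suc n) T[n+1]≡[a+1]X ⟨
    (T * suc n) / suc n                   ≡⟨ m*n/n≡m T (suc n) ⟩
    T                                     ∎
    where
    b = n ∸ a
    X = (n + b) C n
    T = ballotTable n 0 a
    a+b≡n : a + b ≡ n
    a+b≡n = m+[n∸m]≡n a≤n
    2n∸a≡n+b : 2 * n ∸ a ≡ n + b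
    2n∸a≡n+b = trans (cong (λ m → n + m ∸ a) (+-identityʳ n)) (+-∸-assoc n a≤n)
    T[n+1]≡[a+1]X : T * suc n ≡ suc a * X
    T[n+1]≡[a+1]X = +-cancelʳ-≡ (b * X) (T * suc n) (suc a * X) (begin
      T * suc n + b * X                     ≡⟨ cong₂ _+_ (*-comm (suc n) T) ([n+1]*[n+b]C[n+1]≡b*[n+b]Cn n b) ⟨
      suc n * T + suc n * ((n + b) C suc n) ≡⟨ *-distribˡ-+ (suc n) T _ ⟨
      suc n * (T + (n + b) C suc n)         ≡⟨ cong (suc n *_) (ballotTable-closed-form n 0 a b a+b≡n) ⟩
      suc n * X                             ≡⟨ cong (λ m → suc m * X) a+b≡n ⟨
      (suc a + b) * X                       ≡⟨ *-distribʳ-+ X (suc a) b ⟩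
      suc a * X + b * X                     ∎)

module RangeSums {c ℓ : Level} (S : Semiring c ℓ) where
  open Semiring S
  open import Data.Fin using (toℕ)
  open import Data.Fin.Properties using (toℕ<n; toℕ-inject₁; toℕ-fromℕ)
  open import Algebra.Definitions.RawSemiring rawSemiring using (sum)
  open import Algebra.Properties.Semiring.Sum S using (sum-cong-≋; sum-init-last; sum-replicate-zero)
  import Relation.Binary.PropositionalEquality as P

  Σ< : ℕ → (ℕ → Carrier) → Carrier
  Σ< N f = sum {N} (λ i → f (toℕ i))

  Σ<-cong : ∀ N {f g : ℕ → Carrier} → (∀ k → k < N → f k ≈ g k) → Σ< N f ≈ Σ< N g
  Σ<-cong N f≈g = sum-cong-≋ {N} (λ i → f≈g (toℕ i) (toℕ<n i))

  Σ<-zero : ∀ N {f : ℕ → Carrier} → (∀ k → k < N → f k ≈ 0#) → Σ< N f ≈ 0#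
  Σ<-zero N f≈0 = trans (Σ<-cong N f≈0) (sum-replicate-zero N)

  Σ<-last : ∀ N (f : ℕ → Carrier) → Σ< (suc N) f ≈ Σ< N f + f N
  Σ<-last N f = trans (sum-init-last {N} (λ i → f (toℕ i)))
    (+-cong (sum-cong-≋ {N} (λ i → reflexive (P.cong f (toℕ-inject₁ i)))) (reflexive (P.cong f (toℕ-fromℕ N))))

  Σ<-drop-last : ∀ N (f : ℕ → Carrier) → f N ≈ 0# → Σ< (suc N) f ≈ Σ< N f
  Σ<-drop-last N f fN≈0 = trans (Σ<-last N f) (trans (+-congˡ fN≈0) (+-identityʳ _))

module MinorSums {c ℓ : Level} (R : CommutativeRing c ℓ) (x y : CommutativeRing.Carrier R) where
  open CommutativeRing R hiding (zero)
  open import Algebra.Definitions.RawSemiring (Semiring.rawSemiring semiring) using (_×_; _^_)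
  open import Algebra.Properties.Semiring.Sum semiring using (∑-distrib-+; *-distribˡ-sum)
  open import Algebra.Properties.Semiring.Mult semiring using (×-comm-*; ×-congʳ; ×-homo-+)
  open import Algebra.Properties.Ring ring using (-0#≈0#)
  open import Algebra.Properties.CommutativeSemigroup *-commutativeSemigroup using (x∙yz≈y∙xz)
  open import Algebra.Properties.AbelianGroup +-abelianGroup using (∙-cancelʳ)
  open IntegerCoefficients R using (solve; _:=_; _:+_; _:*_; _:-_; con)
  open RangeSums semiring
  open BallotTable using (≤⇒≤-indicator≡1; ballotTable; >⇒ballotTable≡0)
  open import Data.Integer using (0ℤ; 1ℤ)
  open import Data.Fin using (toℕ)
  open import Relation.Binary.PropositionalEquality as P using (_≡_; _≗_)
  open import Relation.Binary.Reasoning.Setoid setoid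

  next : (ℕ → Carrier) → ℕ → Carrier
  next f zero    = x * f zero
  next f (suc k) = f k + y * f (suc k)

  minor : (ℕ → Carrier) → (ℕ → Carrier) → ℕ → Carrier
  minor f g k = f k * g (suc k) - f (suc k) * g k

  weightedMinor : (ℕ → Carrier) → (ℕ → Carrier) → ℕ → Carrier
  weightedMinor f g k = y ^ (2 ℕ.* k) * minor f g k

  minorSum : ℕ → (ℕ → Carrier) → (ℕ → Carrier) → Carrier
  minorSum N f g = Σ< N (weightedMinor f g)

  minorSum-≗ : ∀ N {f f′ g g′} → f ≗ f′ → g ≗ g′ → minorSum N f g ≈ minorSum N f′ g′
  minorSum-≗ N f≗f′ g≗g′ = Σ<-cong N (λ k _ → reflexive (P.cong (y ^ (2 ℕ.* k) *_)
    (P.cong₂ _-_ (P.cong₂ _*_ (f≗f′ k) (g≗g′ (suc k))) (P.cong₂ _*_ (f≗f′ (suc k)) (g≗g′ k)))))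

  minor-self : ∀ f k → minor f f k ≈ 0#
  minor-self f k = trans (+-congˡ (-‿cong (*-comm (f (suc k)) (f k)))) (-‿inverseʳ _)

  minorSum-self : ∀ N f → minorSum N f f ≈ 0#
  minorSum-self N f = Σ<-zero N (λ k _ → trans (*-congˡ (minor-self f k)) (zeroʳ (y ^ (2 ℕ.* k))))

  minor-vanish : ∀ f g k → f k ≈ 0# → f (suc k) ≈ 0# → minor f g k ≈ 0#
  minor-vanish f g k fk≈0 fk+1≈0 = begin
    f k * g (suc k) - f (suc k) * g k  ≈⟨ +-cong (*-congʳ fk≈0) (-‿cong (*-congʳ fk+1≈0)) ⟩
    0# * g (suc k) - 0# * g k          ≈⟨ +-cong (zeroˡ _) (trans (-‿cong (zeroˡ _)) -0#≈0#) ⟩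
    0# + 0#                            ≈⟨ +-identityʳ 0# ⟩
    0#                                 ∎

  minor-next-zero : ∀ f g →
    minor (next f) (next g) 0 + y * y * minor f g 0
      ≈ y * minor f (next g) 0 + y * minor (next f) g 0
  minor-next-zero f g = solve 6 (λ x y f₀ f₁ g₀ g₁ →
      (x :* f₀ :* (g₀ :+ y :* g₁) :- (f₀ :+ y :* f₁) :* (x :* g₀)) :+ y :* y :* (f₀ :* g₁ :- f₁ :* g₀)
      := y :* (f₀ :* (g₀ :+ y :* g₁) :- f₁ :* (x :* g₀)) :+ y :* (x :* f₀ :* g₁ :- (f₀ :+ y :* f₁) :* g₀))
    refl x y (f 0) (f 1) (g 0) (g 1)

  minor-next-suc : ∀ f g k →
    minor (next f) (next g) (suc k) + y * y * minor f g (suc k)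
      ≈ y * minor f (next g) (suc k) + y * minor (next f) g (suc k) + minor f g k
  minor-next-suc f g k = solve 7 (λ y f₀ f₁ f₂ g₀ g₁ g₂ →
      ((f₀ :+ y :* f₁) :* (g₁ :+ y :* g₂) :- (f₁ :+ y :* f₂) :* (g₀ :+ y :* g₁)) :+ y :* y :* (f₁ :* g₂ :- f₂ :* g₁)
      := y :* (f₁ :* (g₁ :+ y :* g₂) :- f₂ :* (g₀ :+ y :* g₁)) :+ y :* ((f₀ :+ y :* f₁) :* g₂ :- (f₁ :+ y :* f₂) :* g₁)
         :+ (f₀ :* g₁ :- f₁ :* g₀))
    refl y (f k) (f (suc k)) (f (suc (suc k))) (g k) (g (suc k)) (g (suc (suc k)))

  scale-relation : ∀ w a b c d e → a + y * y * b ≈ y * c + y * d + e →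
                   w * a + y * y * (w * b) ≈ y * (w * c) + y * (w * d) + w * e
  scale-relation w a b c d e eq = begin
    w * a + y * y * (w * b)            ≈⟨ solve 4 (λ w a b y →
                                            w :* a :+ y :* y :* (w :* b) := w :* (a :+ y :* y :* b)) refl w a b y ⟩
    w * (a + y * y * b)                ≈⟨ *-congˡ eq ⟩
    w * (y * c + y * d + e)            ≈⟨ solve 5 (λ w c d e y →
                                            w :* (y :* c :+ y :* d :+ e) := y :* (w :* c) :+ y :* (w :* d) :+ w :* e)
                                          refl w c d e y ⟩
    y * (w * c) + y * (w * d) + w * e  ∎

  y²-shift : (ℕ → Carrier) → ℕ → Carrier
  y²-shift h zero    = 0#
  y²-shift h (suc k) = y * y * h k

  weight-suc : ∀ k → y ^ (2 ℕ.* suc k) ≈ y * y * y ^ (2 ℕ.* k)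
  weight-suc k = trans (reflexive (P.cong (y ^_) (ℕ.*-suc 2 k))) (sym (*-assoc y y _))

  weightedMinor-next : ∀ f g k →
    weightedMinor (next f) (next g) k + y * y * weightedMinor f g k
      ≈ y * weightedMinor f (next g) k + y * weightedMinor (next f) g k + y²-shift (weightedMinor f g) k
  weightedMinor-next f g zero    =
    trans (scale-relation 1# _ _ _ _ 0# (trans (minor-next-zero f g) (sym (+-identityʳ _))))
          (+-congˡ (zeroʳ 1#))
  weightedMinor-next f g (suc k) =
    trans (scale-relation (y ^ (2 ℕ.* suc k)) _ _ _ _ _ (minor-next-suc f g k))
          (+-congˡ (trans (*-congʳ (weight-suc k)) (*-assoc (y * y) _ _)))

  -- Adding y² Σ B to both sides, the shifted terms of weightedMinor-next reproduce it.
  minorSum-next : ∀ p f g → f (suc p) ≈ 0# → f (suc (suc p)) ≈ 0# →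
    minorSum (suc (suc p)) (next f) (next g)
      ≈ y * minorSum (suc p) f (next g) + y * minorSum (suc (suc p)) (next f) g
  minorSum-next p f g fp+1≈0 fp+2≈0 = ∙-cancelʳ (y * y * Σ< N B) _ _ (begin
    Σ< (suc N) A + y * y * Σ< N B
      ≈⟨ +-congˡ (*-congˡ (Σ<-drop-last N B (vanish g))) ⟨
    Σ< (suc N) A + y * y * Σ< (suc N) B
      ≈⟨ +-congˡ (*-distribˡ-sum {suc N} (y * y) (λ i → B (toℕ i))) ⟩
    Σ< (suc N) A + Σ< (suc N) (λ k → y * y * B k)
      ≈⟨ ∑-distrib-+ {suc N} (λ i → A (toℕ i)) (λ i → y * y * B (toℕ i)) ⟨
    Σ< (suc N) (λ k → A k + y * y * B k)
      ≈⟨ Σ<-cong (suc N) (λ k _ → weightedMinor-next f g k) ⟩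
    Σ< (suc N) (λ k → y * C k + y * D k + y²-shift B k)
      ≈⟨ ∑-distrib-+ {suc N} (λ i → y * C (toℕ i) + y * D (toℕ i)) (λ i → y²-shift B (toℕ i)) ⟩
    Σ< (suc N) (λ k → y * C k + y * D k) + Σ< (suc N) (y²-shift B)
      ≈⟨ +-congʳ (∑-distrib-+ {suc N} (λ i → y * C (toℕ i)) (λ i → y * D (toℕ i))) ⟩
    Σ< (suc N) (λ k → y * C k) + Σ< (suc N) (λ k → y * D k) + (0# + Σ< N (λ k → y * y * B k))
      ≈⟨ +-cong (+-cong (*-distribˡ-sum {suc N} y (λ i → C (toℕ i))) (*-distribˡ-sum {suc N} y (λ i → D (toℕ i))))
                (trans (*-distribˡ-sum {N} (y * y) (λ i → B (toℕ i))) (sym (+-identityˡ _))) ⟨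
    y * Σ< (suc N) C + y * Σ< (suc N) D + y * y * Σ< N B
      ≈⟨ +-congʳ (+-congʳ (*-congˡ (Σ<-drop-last N C (vanish (next g))))) ⟩
    y * Σ< N C + y * Σ< (suc N) D + y * y * Σ< N B ∎)
    where
    N = suc p
    A B C D : ℕ → Carrier
    A = weightedMinor (next f) (next g)
    B = weightedMinor f g
    C = weightedMinor f (next g)
    D = weightedMinor (next f) g
    vanish : ∀ h → weightedMinor f h N ≈ 0#
    vanish h = trans (*-congˡ (minor-vanish f h N fp+1≈0 fp+2≈0)) (zeroʳ _)

  monomial : ℕ → ℕ → Carrier
  monomial e a = x ^ a * y ^ (e ∸ a)

  homPoly : (ℕ → ℕ) → ℕ → ℕ → Carrier
  homPoly c e N = Σ< N (λ a → c a × monomial e a)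

  homPoly-cong : ∀ {c c′} e N → (∀ a → a < N → c a ≡ c′ a) → homPoly c e N ≈ homPoly c′ e N
  homPoly-cong e N c≡c′ = Σ<-cong N (λ a a<N → reflexive (P.cong (_× monomial e a) (c≡c′ a a<N)))

  homPoly-+ : ∀ c c′ e N → homPoly c e N + homPoly c′ e N ≈ homPoly (λ a → c a ℕ.+ c′ a) e N
  homPoly-+ c c′ e N = begin
    homPoly c e N + homPoly c′ e N
      ≈⟨ ∑-distrib-+ {N} (λ i → c (toℕ i) × monomial e (toℕ i)) (λ i → c′ (toℕ i) × monomial e (toℕ i)) ⟨
    Σ< N (λ a → c a × monomial e a + c′ a × monomial e a)
      ≈⟨ Σ<-cong N (λ a _ → ×-homo-+ (monomial e a) (c a) (c′ a)) ⟨
    homPoly (λ a → c a ℕ.+ c′ a) e N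
      ∎

  homPoly-drop-last : ∀ c e N → c N ≡ 0 → homPoly c e (suc N) ≈ homPoly c e N
  homPoly-drop-last c e N cN≡0 =
    Σ<-drop-last N (λ a → c a × monomial e a) (reflexive (P.cong (_× monomial e N) cN≡0))

  y*-monomial : ∀ e a → a ≤ e → y * monomial e a ≈ monomial (suc e) a
  y*-monomial e a a≤e = begin
    y * (x ^ a * y ^ (e ∸ a))  ≈⟨ x∙yz≈y∙xz y (x ^ a) (y ^ (e ∸ a)) ⟩
    x ^ a * y ^ suc (e ∸ a)    ≡⟨ P.cong (λ k → x ^ a * y ^ k) (ℕ.+-∸-assoc 1 a≤e) ⟨
    x ^ a * y ^ (suc e ∸ a)    ∎

  y*-homPoly : ∀ c e N → N ≤ suc e → y * homPoly c e N ≈ homPoly c (suc e) N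
  y*-homPoly c e N N≤1+e = begin
    y * homPoly c e N                      ≈⟨ *-distribˡ-sum {N} y (λ i → c (toℕ i) × monomial e (toℕ i)) ⟩
    Σ< N (λ a → y * (c a × monomial e a))  ≈⟨ Σ<-cong N (λ a a<N → trans (×-comm-* (c a) y (monomial e a))
                                                (×-congʳ (c a) (y*-monomial e a (ℕ.≤-pred (ℕ.≤-trans a<N N≤1+e))))) ⟩
    homPoly c (suc e) N                    ∎

  M : ℕ → ℕ → Carrier
  M = Mtri R x y

  M-next : ∀ n → M (suc n) ≗ next (M n)
  M-next n zero    = P.refl
  M-next n (suc k) = P.refl

  M-vanish : ∀ n k → n < k → M n k ≈ 0#
  M-vanish zero    (suc k) _         = refl
  M-vanish (suc n) (suc k) (s≤s n<k) = begin
    M n k + y * M n (suc k)  ≈⟨ +-cong (M-vanish n k n<k) (*-congˡ (M-vanish n (suc k) (ℕ.m<n⇒m<1+n n<k))) ⟩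
    0# + y * 0#              ≈⟨ trans (+-identityˡ _) (zeroʳ y) ⟩
    0#                       ∎

  M-column-zero : ∀ n → M n 0 ≈ x ^ n
  M-column-zero zero    = refl
  M-column-zero (suc n) = *-congˡ (M-column-zero n)

  M-row-one : ∀ e → M (suc e) 1 ≈ homPoly (λ _ → 1) e (suc e)
  M-row-one zero    = solve 1 (λ y → con 1ℤ :+ y :* con 0ℤ := con 1ℤ :* con 1ℤ :+ con 0ℤ :+ con 0ℤ) refl y
  M-row-one (suc e) = begin
    M (suc e) 0 + y * M (suc e) 1
      ≈⟨ +-cong (M-column-zero (suc e)) (*-congˡ (M-row-one e)) ⟩
    x ^ suc e + y * homPoly (λ _ → 1) e (suc e)
      ≈⟨ +-comm _ _ ⟩
    y * homPoly (λ _ → 1) e (suc e) + x ^ suc e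
      ≈⟨ +-cong (y*-homPoly (λ _ → 1) e (suc e) ℕ.≤-refl) (sym 1×monomial≈x^[1+e]) ⟩
    homPoly (λ _ → 1) (suc e) (suc e) + 1 × monomial (suc e) (suc e)
      ≈⟨ Σ<-last (suc e) (λ a → 1 × monomial (suc e) a) ⟨
    homPoly (λ _ → 1) (suc e) (suc (suc e))
      ∎
    where
    1×monomial≈x^[1+e] : 1 × monomial (suc e) (suc e) ≈ x ^ suc e
    1×monomial≈x^[1+e] = begin
      x ^ suc e * y ^ (suc e ∸ suc e) + 0#  ≈⟨ +-identityʳ _ ⟩
      x ^ suc e * y ^ (suc e ∸ suc e)       ≡⟨ P.cong (λ k → x ^ suc e * y ^ k) (ℕ.n∸n≡0 (suc e)) ⟩
      x ^ suc e * 1#                        ≈⟨ *-identityʳ _ ⟩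
      x ^ suc e                             ∎

  rowMinorSum : ℕ → ℕ → Carrier
  rowMinorSum p q = minorSum (suc p) (M p) (M (suc q))

  rowMinorSum-zero : ∀ q → rowMinorSum 0 q ≈ M (suc q) 1
  rowMinorSum-zero q = solve 2 (λ u v → con 1ℤ :* (con 1ℤ :* u :- con 0ℤ :* v) :+ con 0ℤ := u)
    refl (M (suc q) 1) (M (suc q) 0)

  rowMinorSum-below-diagonal : ∀ n → rowMinorSum (suc n) n ≈ 0#
  rowMinorSum-below-diagonal n = minorSum-self (suc (suc n)) (M (suc n))

  rowMinorSum-suc : ∀ n m →
    rowMinorSum (suc n) (suc m) ≈ y * rowMinorSum n (suc m) + y * rowMinorSum (suc n) m
  rowMinorSum-suc n m = begin
    minorSum (suc (suc n)) (M (suc n)) (M (suc (suc m)))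
      ≈⟨ minorSum-≗ (suc (suc n)) (M-next n) (M-next (suc m)) ⟩
    minorSum (suc (suc n)) (next (M n)) (next (M (suc m)))
      ≈⟨ minorSum-next n (M n) (M (suc m)) (M-vanish n (suc n) (ℕ.n<1+n n))
                                           (M-vanish n (suc (suc n)) (ℕ.m<n⇒m<1+n (ℕ.n<1+n n))) ⟩
    y * minorSum (suc n) (M n) (next (M (suc m))) + y * minorSum (suc (suc n)) (next (M n)) (M (suc m))
      ≈⟨ +-cong (*-congˡ (minorSum-≗ (suc n) (λ k → P.refl {x = M n k}) (M-next (suc m))))
                (*-congˡ (minorSum-≗ (suc (suc n)) (M-next n) (λ k → P.refl {x = M (suc m) k}))) ⟨
    y * rowMinorSum n (suc m) + y * rowMinorSum (suc n) m
      ∎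

  offsetMinorSum : ℕ → ℕ → Carrier
  offsetMinorSum n d = rowMinorSum n (d ℕ.+ n)

  offsetMinorSum-suc-zero : ∀ n → offsetMinorSum (suc n) 0 ≈ y * offsetMinorSum n 1
  offsetMinorSum-suc-zero n = begin
    rowMinorSum (suc n) (suc n)                            ≈⟨ rowMinorSum-suc n n ⟩
    y * rowMinorSum n (suc n) + y * rowMinorSum (suc n) n  ≈⟨ +-congˡ (*-congˡ (rowMinorSum-below-diagonal n)) ⟩
    y * rowMinorSum n (suc n) + y * 0#                     ≈⟨ +-congˡ (zeroʳ y) ⟩
    y * rowMinorSum n (suc n) + 0#                         ≈⟨ +-identityʳ _ ⟩
    y * rowMinorSum n (suc n)                              ∎

  offsetMinorSum-suc-suc : ∀ n d →
    offsetMinorSum (suc n) (suc d) ≈ y * offsetMinorSum n (suc (suc d)) + y * offsetMinorSum (suc n) d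
  offsetMinorSum-suc-suc n d = trans (rowMinorSum-suc n (d ℕ.+ suc n))
    (+-congʳ (*-congˡ (reflexive (P.cong (λ q → rowMinorSum n (suc q)) (ℕ.+-suc d n)))))

  ballotPoly : ℕ → ℕ → Carrier
  ballotPoly n d = homPoly (ballotTable n d) (d ℕ.+ 2 ℕ.* n) (suc (d ℕ.+ n))

  y*-ballotPoly : ∀ n d →
    y * ballotPoly n d ≈ homPoly (ballotTable n d) (suc (d ℕ.+ 2 ℕ.* n)) (suc (d ℕ.+ n))
  y*-ballotPoly n d = y*-homPoly (ballotTable n d) _ _ (s≤s (ℕ.+-monoʳ-≤ d (ℕ.m≤m+n n (n ℕ.+ 0))))

  offsetMinorSum≈ballotPoly : ∀ n d → offsetMinorSum n d ≈ ballotPoly n d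
  offsetMinorSum≈ballotPoly zero    d       = begin
    rowMinorSum 0 (d ℕ.+ 0)                      ≈⟨ rowMinorSum-zero (d ℕ.+ 0) ⟩
    M (suc (d ℕ.+ 0)) 1                          ≈⟨ M-row-one (d ℕ.+ 0) ⟩
    homPoly (λ _ → 1) (d ℕ.+ 0) (suc (d ℕ.+ 0))  ≈⟨ homPoly-cong (d ℕ.+ 0) (suc (d ℕ.+ 0)) (λ a a<1+d+0 →
                                                     P.sym (≤⇒≤-indicator≡1 (ℕ.≤-trans (ℕ.≤-pred a<1+d+0)
                                                                                       (ℕ.≤-reflexive (ℕ.+-identityʳ d))))) ⟩
    ballotPoly 0 d                               ∎
  offsetMinorSum≈ballotPoly (suc n) zero    = begin
    offsetMinorSum (suc n) 0     ≈⟨ offsetMinorSum-suc-zero n ⟩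
    y * offsetMinorSum n 1       ≈⟨ *-congˡ (offsetMinorSum≈ballotPoly n 1) ⟩
    y * ballotPoly n 1           ≈⟨ y*-ballotPoly n 1 ⟩
    homPoly (ballotTable n 1) (suc (1 ℕ.+ 2 ℕ.* n)) (suc (suc n))
      ≡⟨ P.cong (λ e → homPoly (ballotTable n 1) e (suc (suc n))) (ℕ.*-suc 2 n) ⟨
    ballotPoly (suc n) 0         ∎
  offsetMinorSum≈ballotPoly (suc n) (suc d) = begin
    offsetMinorSum (suc n) (suc d)
      ≈⟨ offsetMinorSum-suc-suc n d ⟩
    y * offsetMinorSum n (suc (suc d)) + y * offsetMinorSum (suc n) d
      ≈⟨ +-cong (*-congˡ (offsetMinorSum≈ballotPoly n (suc (suc d)))) (*-congˡ (offsetMinorSum≈ballotPoly (suc n) d)) ⟩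
    y * ballotPoly n (suc (suc d)) + y * ballotPoly (suc n) d
      ≈⟨ +-cong (y*-ballotPoly n (suc (suc d))) (y*-ballotPoly (suc n) d) ⟩
    homPoly c₁ (suc (suc (suc d) ℕ.+ 2 ℕ.* n)) (suc (suc (suc d) ℕ.+ n)) + homPoly c₂ E (suc (d ℕ.+ suc n))
      ≡⟨ P.cong₂ (λ e r → homPoly c₁ e r + homPoly c₂ E (suc (d ℕ.+ suc n))) degree≡ range≡ ⟩
    homPoly c₁ E L + homPoly c₂ E (suc (d ℕ.+ suc n))
      ≈⟨ +-congˡ (homPoly-drop-last c₂ E (suc (d ℕ.+ suc n)) (>⇒ballotTable≡0 (suc n) d _ (ℕ.n<1+n _))) ⟨
    homPoly c₁ E L + homPoly c₂ E L
      ≈⟨ homPoly-+ c₁ c₂ E L ⟩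
    ballotPoly (suc n) (suc d)
      ∎
    where
    c₁ c₂ : ℕ → ℕ
    c₁ = ballotTable n (suc (suc d))
    c₂ = ballotTable (suc n) d
    E = suc (d ℕ.+ 2 ℕ.* suc n)
    L = suc (suc (d ℕ.+ suc n))
    degree≡ : suc (suc (suc d) ℕ.+ 2 ℕ.* n) ≡ E
    degree≡ = P.cong suc (P.sym (P.trans (P.cong (d ℕ.+_) (ℕ.*-suc 2 n))
                                         (P.trans (ℕ.+-suc d _) (P.cong suc (ℕ.+-suc d _)))))
    range≡ : suc (suc (suc d) ℕ.+ n) ≡ L
    range≡ = P.cong (λ r → suc (suc r)) (P.sym (ℕ.+-suc d n))

corollary4p3 : {c ℓ : Level} (R : CommutativeRing c ℓ) (x y : CommutativeRing.Carrier R) (n : ℕ) →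
    CommutativeRing._≈_ R (lhs R x y n) (rhs R x y n)
corollary4p3 R x y n = begin
  lhs R x y n                           ≡⟨⟩
  offsetMinorSum n 0                    ≈⟨ offsetMinorSum≈ballotPoly n 0 ⟩
  ballotPoly n 0                        ≈⟨ homPoly-cong (2 ℕ.* n) (suc n) (λ a a<1+n →
                                             ballot≡ballotTable n a (ℕ.≤-pred a<1+n)) ⟨
  homPoly (ballot n) (2 ℕ.* n) (suc n)  ≡⟨⟩
  rhs R x y n                           ∎
  where
  open MinorSums R x y
  open BallotTable using (ballot≡ballotTable)
  open import Relation.Binary.Reasoning.Setoid (CommutativeRing.setoid R)
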